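{- Let $A$ be a basic $d\times w$ matrix and let $v_1,\dots,v_k$ be columns of $A$ at distinct positions such that $\sum_{i=1}^k\alpha_iv_i=0$ for some nonzero $\alpha_1,\dots,\alpha_k\in\mathbb{Q}$. Then for every constant-coefficient differential operator $D\in\mathbb{Q}[\partial/\partial z_1,\dots,\partial/\partial z_d]$, $\sum_{i=1}^k\alpha_i\,\mathrm{Z}(\hat A_i,D)=0$ as formal series (summand by summand), where $\hat A_i$ is the matrix $A$ with the column $v_i$ removed.
   Context: For $1\le a\le b\le w$, $e_{ab}\in\mathbb{Z}^w$ has $i$-th coordinate $1$ if $a\le i\le b$ and $0$ otherwise. A $d\times w$ matrix is basic if it has rank $d$, has no zero column, and each row equals some $e_{ab}$. For a matrix $M=(m_{ij})$ with $d$ rows and $w'$ columns, $g_M(z)=1/\prod_{j=1}^{w'}(\sum_{i=1}^d m_{ij}z_i)$ and the formal series $\mathrm{Z}(M,D)=\sum_{n\in\mathbb{N}^d}(Dg_M)(n)$ (convergence ignored), $\mathbb{N}=\{1,2,\dots\}$. -}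

module Defs where

open import Data.Nat using (ℕ; zero; suc)
open import Data.Fin using (Fin; zero; suc; toℕ; punchIn) renaming (_≤_ to _≤ᶠ_)
open import Data.Fin.Properties using () renaming (_≤?_ to _≤ᶠ?_)
open import Data.List using (List; []; _∷_)
open import Data.Product using (Σ; _×_; _,_)
open import Data.Rational using (ℚ; 0ℚ; 1ℚ; _+_; _*_; -_; 1/_; _≟_; ≢-nonZero)
open import Relation.Nullary using (yes; no; ¬_)
open import Relation.Nullary.Decidable using (_×-dec_)
open import Relation.Binary.PropositionalEquality using (_≡_)

sumQ : ∀ {n} → (Fin n → ℚ) → ℚ
sumQ {zero}  f = 0ℚ
sumQ {suc n} f = f zero + sumQ (λ i → f (suc i))

eRow : ∀ {w} → Fin w → Fin w → Fin w → ℚ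
eRow a b i with (a ≤ᶠ? i) ×-dec (i ≤ᶠ? b)
... | yes _ = 1ℚ
... | no  _ = 0ℚ

Matrix : ℕ → ℕ → Set
Matrix d w = Fin d → Fin w → ℚ

-- rank d for a d×w matrix: its d rows are linearly independent over ℚ
HasRankRows : ∀ {d w} → Matrix d w → Set
HasRankRows {d} {w} M =
  (c : Fin d → ℚ) → ((j : Fin w) → sumQ (λ i → c i * M i j) ≡ 0ℚ) → (i : Fin d) → c i ≡ 0ℚ

NoZeroColumn : ∀ {d w} → Matrix d w → Set
NoZeroColumn {d} M = ∀ j → ¬ ((i : Fin d) → M i j ≡ 0ℚ)

RowsAreE : ∀ {d w} → Matrix d w → Set
RowsAreE {d} {w} M = (i : Fin d) → Σ (Fin w) λ a → Σ (Fin w) λ b → (a ≤ᶠ b) × ((j : Fin w) → M i j ≡ eRow a b j)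

record Basic {d w} (M : Matrix d w) : Set where
  field
    rank     : HasRankRows M
    noZeroCol : NoZeroColumn M
    rowsE    : RowsAreE M

removeCol : ∀ {d w} → Matrix d (suc w) → Fin (suc w) → Matrix d w
removeCol M p i j = M i (punchIn p j)

data Expr (d : ℕ) : Set where
  const : ℚ → Expr d
  var   : Fin d → Expr d
  _⊕_   : Expr d → Expr d → Expr d
  _⊗_   : Expr d → Expr d → Expr d
  inv   : Expr d → Expr d

∂ : ∀ {d} → Fin d → Expr d → Expr d
∂ k (const q) = const 0ℚ
∂ k (var i) with Data.Fin._≟_ k i
... | yes _ = const 1ℚ
... | no  _ = const 0ℚ
∂ k (e ⊕ f) = ∂ k e ⊕ ∂ k f
∂ k (e ⊗ f) = (∂ k e ⊗ f) ⊕ (e ⊗ ∂ k f)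
∂ k (inv e) = (const (- 1ℚ) ⊗ ∂ k e) ⊗ inv (e ⊗ e)

-- a monomial ∂^β written as a list of partial derivatives to apply
∂s : ∀ {d} → List (Fin d) → Expr d → Expr d
∂s []       e = e
∂s (k ∷ ks) e = ∂ k (∂s ks e)

-- a constant-coefficient operator D = Σ c_β ∂^β ∈ ℚ[∂/∂z_1,…,∂/∂z_d]
DiffOp : ℕ → Set
DiffOp d = List (ℚ × List (Fin d))

applyD : ∀ {d} → DiffOp d → Expr d → Expr d
applyD []              e = const 0ℚ
applyD ((c , β) ∷ D) e = (const c ⊗ ∂s β e) ⊕ applyD D e

-- total reciprocal (value at 0 is irrelevant: never used at points of ℕ^d here)
safeInv : ℚ → ℚ
safeInv q with q ≟ 0ℚ
... | yes _  = 0ℚ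
... | no q≢0 = 1/_ q {{≢-nonZero q≢0}}

eval : ∀ {d} → (Fin d → ℕ) → Expr d → ℚ
eval n (const q) = q
eval n (var i)   = Data.Rational._/_ (Data.Integer.+_ (n i)) 1
  where import Data.Integer
eval n (e ⊕ f)   = eval n e + eval n f
eval n (e ⊗ f)   = eval n e * eval n f
eval n (inv e)   = safeInv (eval n e)

sumE : ∀ {d m} → (Fin m → Expr d) → Expr d
sumE {m = zero}  f = const 0ℚ
sumE {m = suc m} f = f zero ⊕ sumE (λ j → f (suc j))

prodE : ∀ {d m} → (Fin m → Expr d) → Expr d
prodE {m = zero}  f = const 1ℚ
prodE {m = suc m} f = f zero ⊗ prodE (λ j → f (suc j))

g : ∀ {d m} → Matrix d m → Expr d
g M = inv (prodE (λ j → sumE (λ i → const (M i j) ⊗ var i)))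

ZTerm : ∀ {d m} → Matrix d m → DiffOp d → (Fin d → ℕ) → ℚ
ZTerm M D n = eval n (applyD D (g M))

-- Write Lⱼ = Σ_r a_rj z_r for the column forms of A, so that g_{Âᵢ} = 1 / Π_{j ≠ pᵢ} Lⱼ.  Over the
-- common denominator Π_j Lⱼ we get Σᵢ αᵢ g_{Âᵢ} = (Σᵢ αᵢ L_{pᵢ}) / Π_j Lⱼ, and the numerator is
-- Σ_r (Σᵢ αᵢ a_{r pᵢ}) z_r = 0.  This computation is valid in any commutative ℚ-algebra in which
-- the Lⱼ are invertible.  Derivatives are handled by forward-mode differentiation: evaluating an
-- expression at dual numbers (x + ε eₖ, with ε² = 0) yields its value together with its k-th partial
-- derivative, so ∂^β is read off from an evaluation in the |β|-fold iterated dual numbers over ℚ.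
-- The relation survives that evaluation, and taking the ε-component is ℚ-linear.  The Lⱼ stay
-- invertible there because their value at n ∈ ℕ^d is a positive rational: the entries of A lie in
-- {0, 1} and no column vanishes.
module Submission where

open import Defs
open import Level using (0ℓ)
open import Algebra.Bundles using (CommutativeRing; RawRing)
open import Algebra.Core using (Op₁; Op₂)
open import Algebra.Structures using (IsCommutativeRing)
open import Algebra.Morphism.Structures using (module RingMorphisms)
import Algebra.Morphism.Construct.Identity as Identity
open import Data.Empty using (⊥-elim)
open import Data.Fin as Fin using (Fin)
open import Data.Fin.Properties using () renaming (_≤?_ to _≤ᶠ?_)
import Data.Integer as ℤ
open import Data.List using (List; []; _∷_; length)
open import Data.Nat using (ℕ; zero; suc; _≤_)
open import Data.Product using (_×_; _,_; proj₁; proj₂)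
open import Data.Rational as ℚ using (ℚ; 0ℚ; 1ℚ; 1/_)
import Data.Rational.Properties as ℚP
open import Data.Sum using (_⊎_; inj₁; inj₂)
open import Data.Vec.Functional using (removeAt)
open import Function using (id)
open import Function.Definitions using (Injective)
open import Relation.Binary.PropositionalEquality
open import Relation.Nullary using (yes; no)
open import Relation.Nullary.Decidable using (_×-dec_)

open RingMorphisms using (IsRingHomomorphism)

-- _⁻¹ is total; only its values on units are constrained.
record RationalAlgebra : Set₁ where
  infixl 6 _+_
  infixl 7 _*_
  infix  8 -_
  infix  9 _⁻¹
  field
    Carrier : Set
    _+_ _*_ : Op₂ Carrier
    -_      : Op₁ Carrier
    0# 1#   : Carrier
    isCommutativeRing : IsCommutativeRing _≡_ _+_ _*_ -_ 0# 1#

  commutativeRing : CommutativeRing 0ℓ 0ℓ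
  commutativeRing = record { isCommutativeRing = isCommutativeRing }

  open CommutativeRing commutativeRing public using (rawRing)

  field
    ι : ℚ → Carrier
    ι-isRingHomomorphism : IsRingHomomorphism ℚ.+-*-rawRing rawRing ι
    _⁻¹ : Op₁ Carrier
    ⁻¹-unique : ∀ {a b} → a * b ≡ 1# → a ⁻¹ ≡ b

module _ (𝔸 : RationalAlgebra) where
  open RationalAlgebra 𝔸
  open CommutativeRing commutativeRing using (semiring)
  open import Algebra.Properties.Semiring.Sum semiring using (sum-syntax)

  evalIn : ∀ {d} → (Fin d → Carrier) → Expr d → Carrier
  evalIn x (const q) = ι q
  evalIn x (var i)   = x i
  evalIn x (e ⊕ f)   = evalIn x e + evalIn x f
  evalIn x (e ⊗ f)   = evalIn x e * evalIn x f
  evalIn x (inv e)   = evalIn x e ⁻¹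

  Invertible : Carrier → Set
  Invertible a = a * a ⁻¹ ≡ 1#

  linearCombination : ∀ {k} → (Fin k → ℚ) → (Fin k → Carrier) → Carrier
  linearCombination {k} c y = ∑[ i < k ] (ι (c i) * y i)

  columnForm : ∀ {d w} → Matrix d w → (Fin d → Carrier) → Fin w → Carrier
  columnForm M x j = linearCombination (λ r → M r j) x

columnExpr : ∀ {d w} → Matrix d w → Fin w → Expr d
columnExpr M j = sumE (λ r → const (M r j) ⊗ var r)

module Properties (𝔸 : RationalAlgebra) where
  open RationalAlgebra 𝔸
  open CommutativeRing commutativeRing
    using (*-assoc; *-identityˡ; zeroˡ; zeroʳ; semiring; *-commutativeMonoid; commutativeSemiring)
  open IsRingHomomorphism ι-isRingHomomorphism using (+-homo; *-homo; 0#-homo; 1#-homo)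
  open import Algebra.Properties.Semiring.Sum semiring public using (sum)
  open import Algebra.Properties.Semiring.Sum semiring
    using (sum-syntax; sum-cong-≗; ∑-comm; ∑-distrib-+; *-distribˡ-sum; *-distribʳ-sum; sum-replicate-zero)
  open import Algebra.Properties.CommutativeMonoid.Sum *-commutativeMonoid
    using () renaming (sum to prod; sum-remove to prod-removeAt; sum-cong-≗ to prod-cong-≗)
  open import Algebra.Solver.Ring.NaturalCoefficients.Default commutativeSemiring
  open ≡-Reasoning

  invertible : ∀ {a b} → a * b ≡ 1# → Invertible 𝔸 a
  invertible {a} ab≡1 = trans (cong (a *_) (⁻¹-unique ab≡1)) ab≡1

  *-invertible : ∀ {a b} → Invertible 𝔸 a → Invertible 𝔸 b → Invertible 𝔸 (a * b)
  *-invertible {a} {b} ha hb = invertible (begin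
    (a * b) * (a ⁻¹ * b ⁻¹) ≡⟨ solve 4 (λ a b a⁻¹ b⁻¹ → (a :* b) :* (a⁻¹ :* b⁻¹) := (a :* a⁻¹) :* (b :* b⁻¹))
                                 refl a b (a ⁻¹) (b ⁻¹) ⟩
    (a * a ⁻¹) * (b * b ⁻¹) ≡⟨ cong₂ _*_ ha hb ⟩
    1# * 1#                 ≡⟨ *-identityˡ 1# ⟩
    1#                      ∎)

  prod-invertible : ∀ {n} (f : Fin n → Carrier) → (∀ j → Invertible 𝔸 (f j)) → Invertible 𝔸 (prod f)
  prod-invertible {zero}  f hf = invertible (*-identityˡ 1#)
  prod-invertible {suc n} f hf =
    *-invertible (hf Fin.zero) (prod-invertible (λ j → f (Fin.suc j)) (λ j → hf (Fin.suc j)))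

  prod-removeAt-⁻¹ : ∀ {n} (L : Fin (suc n) → Carrier) → (∀ j → Invertible 𝔸 (L j)) →
                     ∀ q → prod (removeAt L q) ⁻¹ ≡ L q * prod L ⁻¹
  prod-removeAt-⁻¹ L hL q = ⁻¹-unique (begin
    prod (removeAt L q) * (L q * prod L ⁻¹) ≡⟨ solve 3 (λ a b c → a :* (b :* c) := (b :* a) :* c) refl _ _ _ ⟩
    (L q * prod (removeAt L q)) * prod L ⁻¹ ≡⟨ cong (_* prod L ⁻¹) (prod-removeAt L) ⟨
    prod L * prod L ⁻¹                      ≡⟨ prod-invertible L hL ⟩
    1#                                      ∎)

  partialFractions-vanish : ∀ {k n} (c : Fin k → Carrier) (p : Fin k → Fin (suc n)) (L : Fin (suc n) → Carrier) →
    (∀ j → Invertible 𝔸 (L j)) → sum (λ i → c i * L (p i)) ≡ 0# →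
    sum (λ i → c i * prod (removeAt L (p i)) ⁻¹) ≡ 0#
  partialFractions-vanish c p L hL numerator≡0 = begin
    sum (λ i → c i * prod (removeAt L (p i)) ⁻¹) ≡⟨ sum-cong-≗ (λ i → cong (c i *_) (prod-removeAt-⁻¹ L hL (p i))) ⟩
    sum (λ i → c i * (L (p i) * prod L ⁻¹))     ≡⟨ sum-cong-≗ (λ i → *-assoc (c i) _ _) ⟨
    sum (λ i → c i * L (p i) * prod L ⁻¹)       ≡⟨ *-distribʳ-sum (prod L ⁻¹) (λ i → c i * L (p i)) ⟨
    sum (λ i → c i * L (p i)) * prod L ⁻¹       ≡⟨ cong (_* prod L ⁻¹) numerator≡0 ⟩
    0# * prod L ⁻¹                              ≡⟨ zeroˡ _ ⟩
    0#                                          ∎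

  ι-sumQ : ∀ {n} (f : Fin n → ℚ) → ι (sumQ f) ≡ sum (λ i → ι (f i))
  ι-sumQ {zero}  f = 0#-homo
  ι-sumQ {suc n} f = trans (+-homo _ _) (cong (ι (f Fin.zero) +_) (ι-sumQ (λ i → f (Fin.suc i))))

  linearCombination-cong : ∀ {k} (c : Fin k → ℚ) {y z : Fin k → Carrier} → (∀ i → y i ≡ z i) →
                           linearCombination 𝔸 c y ≡ linearCombination 𝔸 c z
  linearCombination-cong c y≗z = sum-cong-≗ (λ i → cong (ι (c i) *_) (y≗z i))

  linearCombination-zero : ∀ {k} (c : Fin k → ℚ) → linearCombination 𝔸 c (λ _ → 0#) ≡ 0#
  linearCombination-zero {k} c = trans (sum-cong-≗ (λ i → zeroʳ (ι (c i)))) (sum-replicate-zero k)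

  linearCombination-*-+ : ∀ {k} (c : Fin k → ℚ) a (y z : Fin k → Carrier) →
    linearCombination 𝔸 c (λ i → a * y i + z i) ≡ a * linearCombination 𝔸 c y + linearCombination 𝔸 c z
  linearCombination-*-+ {k} c a y z = begin
    ∑[ i < k ] (ι (c i) * (a * y i + z i))
      ≡⟨ sum-cong-≗ (λ i → solve 4 (λ γ a y z → γ :* (a :* y :+ z) := a :* (γ :* y) :+ γ :* z) refl (ι (c i)) a (y i) (z i)) ⟩
    ∑[ i < k ] (a * (ι (c i) * y i) + ι (c i) * z i)
      ≡⟨ ∑-distrib-+ (λ i → a * (ι (c i) * y i)) (λ i → ι (c i) * z i) ⟩
    ∑[ i < k ] (a * (ι (c i) * y i)) + linearCombination 𝔸 c z
      ≡⟨ cong (_+ linearCombination 𝔸 c z) (*-distribˡ-sum a (λ i → ι (c i) * y i)) ⟨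
    a * linearCombination 𝔸 c y + linearCombination 𝔸 c z ∎

  evalIn-sumE : ∀ {d n} (x : Fin d → Carrier) (f : Fin n → Expr d) → evalIn 𝔸 x (sumE f) ≡ sum (λ j → evalIn 𝔸 x (f j))
  evalIn-sumE {n = zero}  x f = 0#-homo
  evalIn-sumE {n = suc n} x f = cong (evalIn 𝔸 x (f Fin.zero) +_) (evalIn-sumE x (λ j → f (Fin.suc j)))

  evalIn-prodE : ∀ {d n} (x : Fin d → Carrier) (f : Fin n → Expr d) → evalIn 𝔸 x (prodE f) ≡ prod (λ j → evalIn 𝔸 x (f j))
  evalIn-prodE {n = zero}  x f = 1#-homo
  evalIn-prodE {n = suc n} x f = cong (evalIn 𝔸 x (f Fin.zero) *_) (evalIn-prodE x (λ j → f (Fin.suc j)))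

  evalIn-columnExpr : ∀ {d w} (M : Matrix d w) x j → evalIn 𝔸 x (columnExpr M j) ≡ columnForm 𝔸 M x j
  evalIn-columnExpr M x j = evalIn-sumE x (λ r → const (M r j) ⊗ var r)

  evalIn-g : ∀ {d w} (M : Matrix d w) x → evalIn 𝔸 x (g M) ≡ prod (columnForm 𝔸 M x) ⁻¹
  evalIn-g M x = cong _⁻¹ (trans (evalIn-prodE x (columnExpr M)) (prod-cong-≗ (evalIn-columnExpr M x)))

  columnForm-relation : ∀ {d w k} (A : Matrix d w) (p : Fin k → Fin w) (α : Fin k → ℚ) (x : Fin d → Carrier) →
    (∀ r → sumQ (λ i → α i ℚ.* A r (p i)) ≡ 0ℚ) → linearCombination 𝔸 α (λ i → columnForm 𝔸 A x (p i)) ≡ 0#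
  columnForm-relation {d} {w} {k} A p α x relation = begin
    ∑[ i < k ] (ι (α i) * columnForm 𝔸 A x (p i))
      ≡⟨ sum-cong-≗ (λ i → *-distribˡ-sum (ι (α i)) (λ r → ι (A r (p i)) * x r)) ⟩
    ∑[ i < k ] ∑[ r < d ] (ι (α i) * (ι (A r (p i)) * x r))
      ≡⟨ ∑-comm (λ i r → ι (α i) * (ι (A r (p i)) * x r)) ⟩
    ∑[ r < d ] ∑[ i < k ] (ι (α i) * (ι (A r (p i)) * x r))
      ≡⟨ sum-cong-≗ (λ r → sum-cong-≗ {k} (λ i → trans (sym (*-assoc _ _ _)) (cong (_* x r) (sym (*-homo _ _))))) ⟩
    ∑[ r < d ] ∑[ i < k ] (ι (α i ℚ.* A r (p i)) * x r)
      ≡⟨ sum-cong-≗ (λ r → *-distribʳ-sum {k} (x r) (λ i → ι (α i ℚ.* A r (p i)))) ⟨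
    ∑[ r < d ] ((∑[ i < k ] ι (α i ℚ.* A r (p i))) * x r)
      ≡⟨ sum-cong-≗ (λ r → cong (_* x r) (trans (sym (ι-sumQ {k} _)) (trans (cong ι (relation r)) 0#-homo))) ⟩
    ∑[ r < d ] (0# * x r)
      ≡⟨ sum-cong-≗ (λ r → zeroˡ (x r)) ⟩
    ∑[ r < d ] 0#
      ≡⟨ sum-replicate-zero d ⟩
    0# ∎

  g-removeCol-relation : ∀ {d w k} (A : Matrix d (suc w)) (p : Fin k → Fin (suc w)) (α : Fin k → ℚ)
    (x : Fin d → Carrier) → (∀ j → Invertible 𝔸 (columnForm 𝔸 A x j)) →
    (∀ r → sumQ (λ i → α i ℚ.* A r (p i)) ≡ 0ℚ) →
    linearCombination 𝔸 α (λ i → evalIn 𝔸 x (g (removeCol A (p i)))) ≡ 0#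
  g-removeCol-relation A p α x invertibleForms relation =
    trans (sum-cong-≗ (λ i → cong (ι (α i) *_) (evalIn-g (removeCol A (p i)) x)))
          (partialFractions-vanish (λ i → ι (α i)) p (columnForm 𝔸 A x) invertibleForms
                                   (columnForm-relation A p α x relation))

-- (a , a') stands for a + a'ε with ε² = 0.  The ε-parts of products and inverses are the rules of ∂
-- for ⊗ and inv, which is what makes evalIn-dual hold on the nose.
module DualNumbers (𝔸 : RationalAlgebra) where
  open RationalAlgebra 𝔸
  open CommutativeRing commutativeRing
    using (+-assoc; +-comm; +-identityˡ; +-identityʳ; -‿inverseˡ; -‿inverseʳ; *-assoc; *-comm;
           *-identityˡ; *-identityʳ; distribˡ; distribʳ; zeroˡ; zeroʳ; +-group; ring; commutativeSemiring)
  open IsRingHomomorphism ι-isRingHomomorphism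
  open import Algebra.Solver.Ring.NaturalCoefficients.Default commutativeSemiring
  open import Algebra.Properties.Group +-group using (inverseʳ-unique)
  open import Algebra.Properties.Ring ring using (-1*x≈-x)
  open ≡-Reasoning

  D : Set
  D = Carrier × Carrier

  0ᵈ 1ᵈ : D
  0ᵈ = 0# , 0#
  1ᵈ = 1# , 0#

  infixl 6 _+ᵈ_
  infixl 7 _*ᵈ_
  _+ᵈ_ _*ᵈ_ : D → D → D
  (a , a') +ᵈ (b , b') = a + b , a' + b'
  (a , a') *ᵈ (b , b') = a * b , a' * b + a * b'

  -ᵈ_ : D → D
  -ᵈ (a , a') = - a , - a'

  infix 9 _⁻¹ᵈ
  _⁻¹ᵈ : D → D
  (a , a') ⁻¹ᵈ = a ⁻¹ , (ι (ℚ.- 1ℚ) * a') * (a * a) ⁻¹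

  ιᵈ : ℚ → D
  ιᵈ q = ι q , 0#

  isCommutativeRingᵈ : IsCommutativeRing _≡_ _+ᵈ_ _*ᵈ_ -ᵈ_ 0ᵈ 1ᵈ
  isCommutativeRingᵈ = record
    { isRing = record
      { +-isAbelianGroup = record
        { isGroup = record
          { isMonoid = record
            { isSemigroup = record
              { isMagma = record { isEquivalence = isEquivalence ; ∙-cong = cong₂ _+ᵈ_ }
              ; assoc = λ _ _ _ → cong₂ _,_ (+-assoc _ _ _) (+-assoc _ _ _) }
            ; identity = (λ _ → cong₂ _,_ (+-identityˡ _) (+-identityˡ _))
                       , (λ _ → cong₂ _,_ (+-identityʳ _) (+-identityʳ _)) }
          ; inverse = (λ _ → cong₂ _,_ (-‿inverseˡ _) (-‿inverseˡ _))
                    , (λ _ → cong₂ _,_ (-‿inverseʳ _) (-‿inverseʳ _))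
          ; ⁻¹-cong = cong -ᵈ_ }
        ; comm = λ _ _ → cong₂ _,_ (+-comm _ _) (+-comm _ _) }
      ; *-cong = cong₂ _*ᵈ_
      ; *-assoc = λ _ _ _ → cong₂ _,_ (*-assoc _ _ _)
          (solve 6 (λ a a' b b' c c' → (a' :* b :+ a :* b') :* c :+ (a :* b) :* c'
                                     := a' :* (b :* c) :+ a :* (b' :* c :+ b :* c')) refl _ _ _ _ _ _)
      ; *-identity = (λ _ → cong₂ _,_ (*-identityˡ _)
                       (solve 2 (λ a a' → con 0 :* a :+ con 1 :* a' := a') refl _ _))
                   , (λ _ → cong₂ _,_ (*-identityʳ _)
                       (solve 2 (λ a a' → a' :* con 1 :+ a :* con 0 := a') refl _ _))
      ; distrib = (λ _ _ _ → cong₂ _,_ (distribˡ _ _ _)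
                    (solve 6 (λ a a' b b' c c' → a' :* (b :+ c) :+ a :* (b' :+ c')
                                               := (a' :* b :+ a :* b') :+ (a' :* c :+ a :* c')) refl _ _ _ _ _ _))
                , (λ _ _ _ → cong₂ _,_ (distribʳ _ _ _)
                    (solve 6 (λ a a' b b' c c' → (b' :+ c') :* a :+ (b :+ c) :* a'
                                               := (b' :* a :+ b :* a') :+ (c' :* a :+ c :* a')) refl _ _ _ _ _ _)) }
    ; *-comm = λ _ _ → cong₂ _,_ (*-comm _ _)
        (solve 4 (λ a a' b b' → a' :* b :+ a :* b' := b' :* a :+ b :* a') refl _ _ _ _) }

  rawRingᵈ : RawRing 0ℓ 0ℓ
  rawRingᵈ = record { _≈_ = _≡_ ; _+_ = _+ᵈ_ ; _*_ = _*ᵈ_ ; -_ = -ᵈ_ ; 0# = 0ᵈ ; 1# = 1ᵈ }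

  ιᵈ-isRingHomomorphism : IsRingHomomorphism ℚ.+-*-rawRing rawRingᵈ ιᵈ
  ιᵈ-isRingHomomorphism = record
    { isSemiringHomomorphism = record
      { isNearSemiringHomomorphism = record
        { +-isMonoidHomomorphism = record
          { isMagmaHomomorphism = record
            { isRelHomomorphism = record { cong = cong ιᵈ }
            ; homo = λ p q → cong₂ _,_ (+-homo p q) (sym (+-identityˡ 0#)) }
          ; ε-homo = cong (_, 0#) 0#-homo }
        ; *-homo = λ p q → cong₂ _,_ (*-homo p q)
            (sym (trans (cong₂ _+_ (zeroˡ (ι q)) (zeroʳ (ι p))) (+-identityˡ 0#))) }
      ; 1#-homo = cong (_, 0#) 1#-homo }
    ; -‿homo = λ q → cong₂ _,_ (-‿homo q) (sym (trans (sym (+-identityˡ (- 0#))) (-‿inverseʳ 0#))) }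

  ⁻¹ᵈ-unique : ∀ {x y} → x *ᵈ y ≡ 1ᵈ → x ⁻¹ᵈ ≡ y
  ⁻¹ᵈ-unique {a , a'} {b , b'} xy≡1 = cong₂ _,_ (⁻¹-unique ab≡1) ε-part
    where
    ab≡1 : a * b ≡ 1#
    ab≡1 = cong proj₁ xy≡1
    a'b+ab'≡0 : a' * b + a * b' ≡ 0#
    a'b+ab'≡0 = cong proj₂ xy≡1
    a'bb+b'≡0 : a' * (b * b) + b' ≡ 0#
    a'bb+b'≡0 = begin
      a' * (b * b) + b'             ≡⟨ cong (a' * (b * b) +_) (sym (*-identityˡ b')) ⟩
      a' * (b * b) + 1# * b'        ≡⟨ cong (λ u → a' * (b * b) + u * b') (sym ab≡1) ⟩
      a' * (b * b) + (a * b) * b'   ≡⟨ solve 4 (λ a a' b b' → a' :* (b :* b) :+ (a :* b) :* b'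
                                                          := b :* (a' :* b :+ a :* b')) refl a a' b b' ⟩
      b * (a' * b + a * b')         ≡⟨ cong (b *_) a'b+ab'≡0 ⟩
      b * 0#                        ≡⟨ zeroʳ b ⟩
      0#                            ∎
    aabb≡1 : (a * a) * (b * b) ≡ 1#
    aabb≡1 = begin
      (a * a) * (b * b) ≡⟨ solve 2 (λ a b → (a :* a) :* (b :* b) := (a :* b) :* (a :* b)) refl a b ⟩
      (a * b) * (a * b) ≡⟨ cong₂ _*_ ab≡1 ab≡1 ⟩
      1# * 1#           ≡⟨ *-identityˡ 1# ⟩
      1#                ∎
    ε-part : (ι (ℚ.- 1ℚ) * a') * (a * a) ⁻¹ ≡ b'
    ε-part = begin
      (ι (ℚ.- 1ℚ) * a') * (a * a) ⁻¹ ≡⟨ cong₂ (λ u v → (u * a') * v) (trans (-‿homo 1ℚ) (cong -_ 1#-homo))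
                                          (⁻¹-unique aabb≡1) ⟩
      (- 1# * a') * (b * b)           ≡⟨ *-assoc (- 1#) a' (b * b) ⟩
      - 1# * (a' * (b * b))           ≡⟨ -1*x≈-x _ ⟩
      - (a' * (b * b))                ≡⟨ sym (inverseʳ-unique _ _ a'bb+b'≡0) ⟩
      b'                              ∎

dual : RationalAlgebra → RationalAlgebra
dual 𝔸 = record
  { Carrier = D
  ; _+_ = _+ᵈ_ ; _*_ = _*ᵈ_ ; -_ = -ᵈ_ ; 0# = 0ᵈ ; 1# = 1ᵈ
  ; isCommutativeRing = isCommutativeRingᵈ
  ; ι = ιᵈ
  ; ι-isRingHomomorphism = ιᵈ-isRingHomomorphism
  ; _⁻¹ = _⁻¹ᵈ
  ; ⁻¹-unique = ⁻¹ᵈ-unique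
  }
  where open DualNumbers 𝔸

module _ (𝔸 : RationalAlgebra) where
  open RationalAlgebra 𝔸
  open CommutativeRing commutativeRing
    using (+-identityˡ; zeroˡ; *-identityˡ; -‿inverseʳ; ring; commutativeSemiring)
  open IsRingHomomorphism ι-isRingHomomorphism using (0#-homo; 1#-homo)
  open import Algebra.Properties.Ring ring using (-‿distribʳ-*)
  open import Algebra.Solver.Ring.NaturalCoefficients.Default commutativeSemiring
  open ≡-Reasoning

  δ : ∀ {d} → Fin d → Fin d → Carrier
  δ k i with k Fin.≟ i
  ... | yes _ = 1#
  ... | no  _ = 0#

  lift : ∀ {d} → Fin d → (Fin d → Carrier) → Fin d → Carrier × Carrier
  lift k x r = x r , δ k r

  evalIn-dual : ∀ {d} (k : Fin d) (x : Fin d → Carrier) (e : Expr d) →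
                evalIn (dual 𝔸) (lift k x) e ≡ (evalIn 𝔸 x e , evalIn 𝔸 x (∂ k e))
  evalIn-dual k x (const q) = cong (ι q ,_) (sym 0#-homo)
  evalIn-dual k x (var i) with k Fin.≟ i
  ... | yes _ = cong (x i ,_) (sym 1#-homo)
  ... | no  _ = cong (x i ,_) (sym 0#-homo)
  evalIn-dual k x (e ⊕ f) = cong₂ (RationalAlgebra._+_ (dual 𝔸)) (evalIn-dual k x e) (evalIn-dual k x f)
  evalIn-dual k x (e ⊗ f) = cong₂ (RationalAlgebra._*_ (dual 𝔸)) (evalIn-dual k x e) (evalIn-dual k x f)
  evalIn-dual k x (inv e) = cong (RationalAlgebra._⁻¹ (dual 𝔸)) (evalIn-dual k x e)

  proj₂-linearCombination : ∀ {k} (c : Fin k → ℚ) (y : Fin k → Carrier × Carrier) →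
    proj₂ (linearCombination (dual 𝔸) c y) ≡ linearCombination 𝔸 c (λ i → proj₂ (y i))
  proj₂-linearCombination {zero}  c y = refl
  proj₂-linearCombination {suc k} c y = cong₂ _+_
    (trans (cong (_+ ι (c Fin.zero) * proj₂ (y Fin.zero)) (zeroˡ _)) (+-identityˡ _))
    (proj₂-linearCombination (λ i → c (Fin.suc i)) (λ i → y (Fin.suc i)))

  dual-invertible : ∀ {a} a' → Invertible 𝔸 a → Invertible (dual 𝔸) (a , a')
  dual-invertible {a} a' ha = Properties.invertible (dual 𝔸) (cong₂ _,_ ha tangent≡0)
    where
    cancel : a * (a' * (a ⁻¹ * a ⁻¹)) ≡ a' * a ⁻¹
    cancel = begin
      a * (a' * (a ⁻¹ * a ⁻¹)) ≡⟨ solve 3 (λ a a' a⁻¹ → a :* (a' :* (a⁻¹ :* a⁻¹)) := (a :* a⁻¹) :* (a' :* a⁻¹))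
                                  refl a a' (a ⁻¹) ⟩
      (a * a ⁻¹) * (a' * a ⁻¹) ≡⟨ cong (_* (a' * a ⁻¹)) ha ⟩
      1# * (a' * a ⁻¹)         ≡⟨ *-identityˡ _ ⟩
      a' * a ⁻¹                ∎
    tangent≡0 : a' * a ⁻¹ + a * - (a' * (a ⁻¹ * a ⁻¹)) ≡ 0#
    tangent≡0 = begin
      a' * a ⁻¹ + a * - (a' * (a ⁻¹ * a ⁻¹))   ≡⟨ cong (a' * a ⁻¹ +_) (-‿distribʳ-* a _) ⟨
      a' * a ⁻¹ + - (a * (a' * (a ⁻¹ * a ⁻¹))) ≡⟨ cong (λ t → a' * a ⁻¹ + - t) cancel ⟩
      a' * a ⁻¹ + - (a' * a ⁻¹)                ≡⟨ -‿inverseʳ _ ⟩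
      0#                                       ∎

dual^ : ℕ → RationalAlgebra → RationalAlgebra
dual^ zero    𝔸 = 𝔸
dual^ (suc n) 𝔸 = dual^ n (dual 𝔸)

tangent : ∀ 𝔸 n → RationalAlgebra.Carrier (dual^ n 𝔸) → RationalAlgebra.Carrier 𝔸
tangent 𝔸 zero    y = y
tangent 𝔸 (suc n) y = proj₂ (tangent (dual 𝔸) n y)

tangent-linearCombination : ∀ {k} 𝔸 n (c : Fin k → ℚ) (y : Fin k → RationalAlgebra.Carrier (dual^ n 𝔸)) →
  tangent 𝔸 n (linearCombination (dual^ n 𝔸) c y) ≡ linearCombination 𝔸 c (λ i → tangent 𝔸 n (y i))
tangent-linearCombination 𝔸 zero    c y = refl
tangent-linearCombination 𝔸 (suc n) c y = trans (cong proj₂ (tangent-linearCombination (dual 𝔸) n c y))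
                                                (proj₂-linearCombination 𝔸 c (λ i → tangent (dual 𝔸) n (y i)))

module _ {d : ℕ} where
  open RationalAlgebra using (Carrier)

  liftAll : ∀ 𝔸 (β : List (Fin d)) → (Fin d → Carrier 𝔸) → Fin d → Carrier (dual^ (length β) 𝔸)
  liftAll 𝔸 []      x = x
  liftAll 𝔸 (k ∷ β) x = liftAll (dual 𝔸) β (lift 𝔸 k x)

  evalIn-∂s : ∀ 𝔸 (β : List (Fin d)) x e →
    evalIn 𝔸 x (∂s β e) ≡ tangent 𝔸 (length β) (evalIn (dual^ (length β) 𝔸) (liftAll 𝔸 β x) e)
  evalIn-∂s 𝔸 []      x e = refl
  evalIn-∂s 𝔸 (k ∷ β) x e =
    trans (cong proj₂ (sym (evalIn-dual 𝔸 k x (∂s β e)))) (cong proj₂ (evalIn-∂s (dual 𝔸) β (lift 𝔸 k x) e))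

  invertible-liftAll : ∀ 𝔸 (β : List (Fin d)) x e → Invertible 𝔸 (evalIn 𝔸 x e) →
    Invertible (dual^ (length β) 𝔸) (evalIn (dual^ (length β) 𝔸) (liftAll 𝔸 β x) e)
  invertible-liftAll 𝔸 []      x e h = h
  invertible-liftAll 𝔸 (k ∷ β) x e h = invertible-liftAll (dual 𝔸) β (lift 𝔸 k x) e
    (subst (Invertible (dual 𝔸)) (sym (evalIn-dual 𝔸 k x e)) (dual-invertible 𝔸 _ h))

gÂ : ∀ {d w k} → Matrix d (suc w) → (Fin k → Fin (suc w)) → Fin k → Expr d
gÂ A p i = g (removeCol A (p i))

module _ {d w k} (A : Matrix d (suc w)) (p : Fin k → Fin (suc w)) (α : Fin k → ℚ)
         (relation : ∀ r → sumQ (λ i → α i ℚ.* A r (p i)) ≡ 0ℚ)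
         (𝔸 : RationalAlgebra) (x : Fin d → RationalAlgebra.Carrier 𝔸)
         (invertibleForms : ∀ j → Invertible 𝔸 (columnForm 𝔸 A x j)) where
  open RationalAlgebra 𝔸
  open Properties 𝔸
  open CommutativeRing commutativeRing using (zeroʳ; +-identityʳ)
  open IsRingHomomorphism ι-isRingHomomorphism using (0#-homo)
  open ≡-Reasoning

  ∂s-gÂ-relation : ∀ β → linearCombination 𝔸 α (λ i → evalIn 𝔸 x (∂s β (gÂ A p i))) ≡ 0#
  ∂s-gÂ-relation β = begin
    linearCombination 𝔸 α (λ i → evalIn 𝔸 x (∂s β (gÂ A p i)))
      ≡⟨ linearCombination-cong α (λ i → evalIn-∂s 𝔸 β x (gÂ A p i)) ⟩
    linearCombination 𝔸 α (λ i → tangent 𝔸 n (evalIn 𝕋 X (gÂ A p i)))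
      ≡⟨ tangent-linearCombination 𝔸 n α (λ i → evalIn 𝕋 X (gÂ A p i)) ⟨
    tangent 𝔸 n (linearCombination 𝕋 α (λ i → evalIn 𝕋 X (gÂ A p i)))
      ≡⟨ cong (tangent 𝔸 n) (Properties.g-removeCol-relation 𝕋 A p α X invertibleFormsᵀ relation) ⟩
    tangent 𝔸 n (RationalAlgebra.0# 𝕋)
      ≡⟨ tangent-linearCombination {k = 0} 𝔸 n (λ ()) (λ ()) ⟩
    0# ∎
    where
    n : ℕ
    n = length β
    𝕋 : RationalAlgebra
    𝕋 = dual^ n 𝔸
    X : Fin d → RationalAlgebra.Carrier 𝕋
    X = liftAll 𝔸 β x
    invertibleFormsᵀ : ∀ j → Invertible 𝕋 (columnForm 𝕋 A X j)
    invertibleFormsᵀ j = subst (Invertible 𝕋) (Properties.evalIn-columnExpr 𝕋 A X j)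
      (invertible-liftAll 𝔸 β x (columnExpr A j)
        (subst (Invertible 𝔸) (sym (evalIn-columnExpr A x j)) (invertibleForms j)))

  applyD-gÂ-relation : ∀ D → linearCombination 𝔸 α (λ i → evalIn 𝔸 x (applyD D (gÂ A p i))) ≡ 0#
  applyD-gÂ-relation [] = trans (linearCombination-cong α (λ _ → 0#-homo)) (linearCombination-zero α)
  applyD-gÂ-relation ((c , β) ∷ D) = begin
    linearCombination 𝔸 α (λ i → ι c * evalIn 𝔸 x (∂s β (gÂ A p i)) + evalIn 𝔸 x (applyD D (gÂ A p i)))
      ≡⟨ linearCombination-*-+ α (ι c) _ _ ⟩
    ι c * linearCombination 𝔸 α (λ i → evalIn 𝔸 x (∂s β (gÂ A p i)))
      + linearCombination 𝔸 α (λ i → evalIn 𝔸 x (applyD D (gÂ A p i)))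
      ≡⟨ cong₂ (λ s t → ι c * s + t) (∂s-gÂ-relation β) (applyD-gÂ-relation D) ⟩
    ι c * 0# + 0#
      ≡⟨ trans (+-identityʳ _) (zeroʳ (ι c)) ⟩
    0# ∎

safeInv-unique : ∀ {p q} → p ℚ.* q ≡ 1ℚ → safeInv p ≡ q
safeInv-unique {p} {q} pq≡1 with p ℚ.≟ 0ℚ
... | yes refl = ⊥-elim (ℚP.1≢0 (trans (sym pq≡1) (ℚP.*-zeroˡ q)))
... | no p≢0 = begin
  1/ p               ≡⟨ ℚP.*-identityʳ _ ⟨
  1/ p ℚ.* 1ℚ        ≡⟨ cong (1/ p ℚ.*_) pq≡1 ⟨
  1/ p ℚ.* (p ℚ.* q) ≡⟨ ℚP.*-assoc (1/ p) p q ⟨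
  1/ p ℚ.* p ℚ.* q   ≡⟨ cong (ℚ._* q) (ℚP.*-inverseˡ p) ⟩
  1ℚ ℚ.* q           ≡⟨ ℚP.*-identityˡ q ⟩
  q                  ∎
  where
  open ≡-Reasoning
  instance _ = ℚ.≢-nonZero p≢0

ℚ-algebra : RationalAlgebra
ℚ-algebra = record
  { Carrier = ℚ ; _+_ = ℚ._+_ ; _*_ = ℚ._*_ ; -_ = ℚ.-_ ; 0# = 0ℚ ; 1# = 1ℚ
  ; isCommutativeRing = ℚP.+-*-isCommutativeRing
  ; ι = id
  ; ι-isRingHomomorphism = Identity.isRingHomomorphism ℚ.+-*-rawRing refl
  ; _⁻¹ = safeInv
  ; ⁻¹-unique = λ {p} {q} → safeInv-unique {p} {q}
  }

open Properties ℚ-algebra using (sum; invertible)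

eval≡evalIn : ∀ {d} (n : Fin d → ℕ) e → eval n e ≡ evalIn ℚ-algebra (λ r → eval n (var r)) e
eval≡evalIn n (const q) = refl
eval≡evalIn n (var i)   = refl
eval≡evalIn n (e ⊕ f)   = cong₂ ℚ._+_ (eval≡evalIn n e) (eval≡evalIn n f)
eval≡evalIn n (e ⊗ f)   = cong₂ ℚ._*_ (eval≡evalIn n e) (eval≡evalIn n f)
eval≡evalIn n (inv e)   = cong safeInv (eval≡evalIn n e)

sumQ≡sum : ∀ {n} (f : Fin n → ℚ) → sumQ f ≡ sum f
sumQ≡sum {zero}  f = refl
sumQ≡sum {suc n} f = cong (f Fin.zero ℚ.+_) (sumQ≡sum (λ i → f (Fin.suc i)))

nonzero⇒invertible : ∀ {q} → q ≢ 0ℚ → Invertible ℚ-algebra q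
nonzero⇒invertible {q} q≢0 = invertible {q} {1/ q} (ℚP.*-inverseʳ q)
  where instance _ = ℚ.≢-nonZero q≢0

nonneg+nonneg≡0 : ∀ {a b} → 0ℚ ℚ.≤ a → 0ℚ ℚ.≤ b → a ℚ.+ b ≡ 0ℚ → a ≡ 0ℚ × b ≡ 0ℚ
nonneg+nonneg≡0 {a} {b} 0≤a 0≤b a+b≡0 = a≡0 , b≡0
  where
  a≡0 : a ≡ 0ℚ
  a≡0 = ℚP.≤-antisym (subst₂ ℚ._≤_ (ℚP.+-identityʳ a) a+b≡0 (ℚP.+-monoʳ-≤ a 0≤b)) 0≤a
  b≡0 : b ≡ 0ℚ
  b≡0 = trans (sym (ℚP.+-identityˡ b)) (trans (cong (ℚ._+ b) (sym a≡0)) a+b≡0)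

sum-nonneg : ∀ {n} (f : Fin n → ℚ) → (∀ i → 0ℚ ℚ.≤ f i) → 0ℚ ℚ.≤ sum f
sum-nonneg {zero}  f f≥0 = ℚP.≤-refl
sum-nonneg {suc n} f f≥0 = ℚP.+-mono-≤ (f≥0 Fin.zero) (sum-nonneg (λ i → f (Fin.suc i)) (λ i → f≥0 (Fin.suc i)))

nonneg-sum≡0 : ∀ {n} (f : Fin n → ℚ) → (∀ i → 0ℚ ℚ.≤ f i) → sum f ≡ 0ℚ → ∀ i → f i ≡ 0ℚ
nonneg-sum≡0 {suc n} f f≥0 sum≡0 i
  with nonneg+nonneg≡0 (f≥0 Fin.zero) (sum-nonneg _ (λ i → f≥0 (Fin.suc i))) sum≡0
nonneg-sum≡0 {suc n} f f≥0 sum≡0 Fin.zero    | f₀≡0 , _ = f₀≡0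
nonneg-sum≡0 {suc n} f f≥0 sum≡0 (Fin.suc i) | _ , rest≡0 =
  nonneg-sum≡0 (λ i → f (Fin.suc i)) (λ i → f≥0 (Fin.suc i)) rest≡0 i

eRow-01 : ∀ {w} (a b i : Fin w) → eRow a b i ≡ 0ℚ ⊎ eRow a b i ≡ 1ℚ
eRow-01 a b i with (a ≤ᶠ? i) ×-dec (i ≤ᶠ? b)
... | yes _ = inj₂ refl
... | no  _ = inj₁ refl

basic-entry-01 : ∀ {d w} {A : Matrix d w} → Basic A → ∀ r j → A r j ≡ 0ℚ ⊎ A r j ≡ 1ℚ
basic-entry-01 basic r j with Basic.rowsE basic r
... | a , b , _ , A≡e with eRow-01 a b j
...   | inj₁ e≡0 = inj₁ (trans (A≡e j) e≡0)
...   | inj₂ e≡1 = inj₂ (trans (A≡e j) e≡1)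

01*pos-nonneg : ∀ {a x} → a ≡ 0ℚ ⊎ a ≡ 1ℚ → 0ℚ ℚ.< x → 0ℚ ℚ.≤ a ℚ.* x
01*pos-nonneg {x = x} (inj₁ refl) 0<x = ℚP.≤-reflexive (sym (ℚP.*-zeroˡ x))
01*pos-nonneg {x = x} (inj₂ refl) 0<x = subst (0ℚ ℚ.≤_) (sym (ℚP.*-identityˡ x)) (ℚP.<⇒≤ 0<x)

01*pos≡0 : ∀ {a x} → a ≡ 0ℚ ⊎ a ≡ 1ℚ → 0ℚ ℚ.< x → a ℚ.* x ≡ 0ℚ → a ≡ 0ℚ
01*pos≡0         (inj₁ a≡0)  0<x ax≡0 = a≡0
01*pos≡0 {x = x} (inj₂ refl) 0<x ax≡0 = ⊥-elim (ℚP.<⇒≢ 0<x (sym (trans (sym (ℚP.*-identityˡ x)) ax≡0)))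

columnForm-nonzero : ∀ {d w} {A : Matrix d w} → Basic A → (x : Fin d → ℚ) → (∀ r → 0ℚ ℚ.< x r) →
                     ∀ j → columnForm ℚ-algebra A x j ≢ 0ℚ
columnForm-nonzero {A = A} basic x x>0 j form≡0 =
  Basic.noZeroCol basic j (λ r → 01*pos≡0 (entry r) (x>0 r)
    (nonneg-sum≡0 (λ r → A r j ℚ.* x r) (λ r → 01*pos-nonneg (entry r) (x>0 r)) form≡0 r))
  where
  entry : ∀ r → A r j ≡ 0ℚ ⊎ A r j ≡ 1ℚ
  entry r = basic-entry-01 basic r j

fromℕ-pos : ∀ {m} → 1 ≤ m → 0ℚ ℚ.< ℤ.+ m ℚ./ 1
fromℕ-pos {suc m} _ = ℚP.positive⁻¹ _ {{ℚP.normalize-pos (suc m) 1}}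

-- Not imported at the top: there it would clash with the field _*_ of RationalAlgebra.
open import Data.Rational using (_*_)

mainTheorem6 : (d w k : ℕ) (A : Matrix d (ℕ.suc w)) → Basic A
    → (p : Fin k → Fin (ℕ.suc w)) → Injective _≡_ _≡_ p
    → (α : Fin k → ℚ) → ((i : Fin k) → α i ≢ 0ℚ)
    → ((r : Fin d) → sumQ (λ i → α i * A r (p i)) ≡ 0ℚ)
    → (D : DiffOp d) (n : Fin d → ℕ) → ((r : Fin d) → 1 ≤ n r)
    → sumQ (λ i → α i * ZTerm (removeCol A (p i)) D n) ≡ 0ℚ
mainTheorem6 d w k A basic p _ α _ relation D n n≥1 = begin
  sumQ (λ i → α i * eval n (applyD D (gÂ A p i)))
    ≡⟨ sumQ≡sum {k} _ ⟩
  linearCombination ℚ-algebra α (λ i → eval n (applyD D (gÂ A p i)))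
    ≡⟨ Properties.linearCombination-cong ℚ-algebra α (λ i → eval≡evalIn n (applyD D (gÂ A p i))) ⟩
  linearCombination ℚ-algebra α (λ i → evalIn ℚ-algebra x (applyD D (gÂ A p i)))
    ≡⟨ applyD-gÂ-relation A p α relation ℚ-algebra x invertibleForms D ⟩
  0ℚ ∎
  where
  open ≡-Reasoning
  x : Fin d → ℚ
  x r = eval n (var r)
  invertibleForms : ∀ j → Invertible ℚ-algebra (columnForm ℚ-algebra A x j)
  invertibleForms j = nonzero⇒invertible (columnForm-nonzero basic x (λ r → fromℕ-pos (n≥1 r)) j)
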